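{- Let $G$ be a connected graph and $v\in V(G)$. Then $$\chi_d^t(G)-2\leq \chi_d^t(G/v)\leq \chi_d^t(G)+\deg(v)-1.$$
   Context: All graphs are simple and finite. For a graph with no isolated vertex, a total dominator coloring (TD-coloring) is a proper vertex coloring in which every vertex is adjacent to every vertex of some color class (a class other than its own); $\chi_d^t$ denotes the minimum number of colors in such a coloring. The vertex contraction $G/v$ is the graph obtained from $G$ by deleting $v$ and making the open neighbourhood of $v$ a clique (pairs of neighbours already adjacent stay simply adjacent). Implicitly, every graph whose $\chi_d^t$ appears has no isolated vertex. -}

module Defs where

open import Data.Nat using (ℕ; zero; suc; _≤_; _+_)
open import Data.Fin using (Fin; punchIn; _≟_)
open import Data.Bool using (Bool; true; false; _∧_; _∨_; not)
open import Data.Bool.Properties using (∧-assoc)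
open import Data.Empty using (⊥-elim)
open import Data.List using (length; filterᵇ; allFin)
open import Data.Product using (Σ; ∃; _×_; _,_)
open import Relation.Nullary using (¬_; does; yes; no)
open import Relation.Binary.PropositionalEquality using (_≡_; _≢_; refl) renaming (sym to sym≡)

record Graph (n : ℕ) : Set where
  field
    adj   : Fin n → Fin n → Bool
    sym   : ∀ x y → adj x y ≡ adj y x
    irrefl : ∀ x → adj x x ≡ false
open Graph public

Adj : ∀ {n} → Graph n → Fin n → Fin n → Set
Adj G x y = adj G x y ≡ true

NoIsolated : ∀ {n} → Graph n → Set
NoIsolated {n} G = ∀ x → ∃ λ (y : Fin n) → Adj G x y

data Reach {n} (G : Graph n) : Fin n → Fin n → Set where
  here : ∀ {x} → Reach G x x
  step : ∀ {x y z} → Adj G x y → Reach G y z → Reach G x z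

Connected : ∀ {n} → Graph n → Set
Connected G = ∀ x y → Reach G x y

deg : ∀ {n} → Graph n → Fin n → ℕ
deg {n} G v = length (filterᵇ (adj G v) (allFin n))

-- Vertex contraction G/v: delete v (vertices of G/v are indexed by
-- Fin n via punchIn v) and make N(v) a clique.
contractAdj : ∀ {n} → Graph (suc n) → Fin (suc n) → Fin n → Fin n → Bool
contractAdj G v i j =
  adj G (punchIn v i) (punchIn v j)
  ∨ (adj G v (punchIn v i) ∧ adj G v (punchIn v j) ∧ not (does (i ≟ j)))

private
  ∧-comm : ∀ a b → a ∧ b ≡ b ∧ a
  ∧-comm false false = refl
  ∧-comm false true = refl
  ∧-comm true false = refl
  ∧-comm true true = refl

  ∧-false : ∀ a → a ∧ false ≡ false
  ∧-false false = refl
  ∧-false true = refl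

  ≟-sym : ∀ {n} (i j : Fin n) → does (i ≟ j) ≡ does (j ≟ i)
  ≟-sym i j with i ≟ j | j ≟ i
  ... | yes _ | yes _ = refl
  ... | no _ | no _ = refl
  ... | yes p | no q = ⊥-elim (q (sym≡ p))
  ... | no p | yes q = ⊥-elim (p (sym≡ q))

  ≟-diag : ∀ {n} (i : Fin n) → does (i ≟ i) ≡ true
  ≟-diag i with i ≟ i
  ... | yes _ = refl
  ... | no p = ⊥-elim (p refl)

contract : ∀ {n} → Graph (suc n) → Fin (suc n) → Graph n
contract G v = record
  { adj = contractAdj G v
  ; sym = λ i j → begin-sym i j
  ; irrefl = λ i → irr i
  }
  where
  begin-sym : ∀ i j → contractAdj G v i j ≡ contractAdj G v j i
  begin-sym i j rewrite sym G (punchIn v i) (punchIn v j)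
                      | ≟-sym i j
                      | ∧-comm (adj G v (punchIn v i)) (adj G v (punchIn v j) ∧ not (does (j ≟ i)))
                      | ∧-assoc (adj G v (punchIn v j)) (not (does (j ≟ i))) (adj G v (punchIn v i))
                      | ∧-comm (not (does (j ≟ i))) (adj G v (punchIn v i)) = refl
  irr : ∀ i → contractAdj G v i i ≡ false
  irr i rewrite irrefl G (punchIn v i) | ≟-diag i
              | ∧-false (adj G v (punchIn v i)) | ∧-false (adj G v (punchIn v i)) = refl

Proper : ∀ {n k} → Graph n → (Fin n → Fin k) → Set
Proper G c = ∀ x y → Adj G x y → c x ≢ c y

DominatesClass : ∀ {n k} → Graph n → (Fin n → Fin k) → Fin n → Fin k → Set
DominatesClass {n} G c x a =
  (a ≢ c x) × (∃ λ (y : Fin n) → c y ≡ a) × (∀ y → c y ≡ a → Adj G x y)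

IsTDColoring : ∀ {n k} → Graph n → (Fin n → Fin k) → Set
IsTDColoring {n} {k} G c =
  Proper G c × (∀ x → ∃ λ (a : Fin k) → DominatesClass G c x a)

HasTDColoring : ∀ {n} → Graph n → ℕ → Set
HasTDColoring {n} G k = ∃ λ (c : Fin n → Fin k) → IsTDColoring G c

IsChiDT : ∀ {n} → Graph n → ℕ → Set
IsChiDT G k = HasTDColoring G k × (∀ m → HasTDColoring G m → k ≤ m)

-- Moving some vertices into new singleton colour classes keeps a colouring
-- proper, and every vertex still dominates a class: a class it dominated either
-- still has a member of its old colour, or was entirely split into singletons,
-- all adjacent to it.
-- Lower bound: lift a TD-colouring of G/v to G and put v and a neighbour u of v
-- into two new singleton classes; v dominates {u}, the neighbours of v dominate
-- {v}, and every other vertex has the same neighbourhood in G and in G/v.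
-- Upper bound: restrict a TD-colouring of G to G/v and put all but the last of
-- the d neighbours of v into new singleton classes, so that the clique on N(v)
-- stays properly coloured. Only a vertex that dominated nothing but the class
-- {v} can fail; then the colour of v is free in G/v, and giving it to the last
-- neighbour (d ≥ 2) or to a neighbour in G/v of the only neighbour of v (d = 1)
-- creates a singleton class that such a vertex dominates.
module Submission where

open import Defs
open import Data.Bool using (Bool; true; false; if_then_else_)
open import Data.Bool.Properties using (∨-zeroʳ) renaming (_≟_ to _≟ᵇ_)
open import Data.Empty using (⊥; ⊥-elim)
open import Data.Fin using (Fin; zero; suc; punchIn; punchOut; toℕ; fromℕ<; _↑ˡ_; _↑ʳ_; splitAt; _≟_)
open import Data.Fin.Properties
  using (any?; punchIn-punchOut; punchInᵢ≢i; suc-injective; toℕ-fromℕ<; ↑ˡ-injective; ↑ʳ-injective;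
         splitAt-↑ˡ; splitAt-↑ʳ)
open import Data.List using (length; filterᵇ; tabulate)
open import Data.Nat using (ℕ; zero; suc; _+_; _≤_; _<_; z≤n; s≤s; s≤s⁻¹)
open import Data.Nat.Properties using (_<?_; ≤-antisym; ≮⇒≥; m<1+n⇒m≤n; +-comm; +-suc)
import Data.Nat.Properties as ℕ
open import Data.Product using (∃; _×_; _,_; proj₁; proj₂)
open import Data.Sum using (_⊎_; inj₁; inj₂)
open import Data.Vec.Functional using (insertAt)
open import Data.Vec.Functional.Properties using (insertAt-lookup; insertAt-punchIn)
open import Function using (_∘_; id)
open import Function.Definitions using (Injective)
open import Relation.Nullary using (¬_; Dec; yes; no)
open import Relation.Nullary.Decidable using (_×-dec_; _⊎-dec_; ¬?; decidable-stable)
open import Relation.Binary.PropositionalEquality as ≡ using (_≡_; _≢_; refl; trans; cong; subst)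

↑ˡ≢↑ʳ : ∀ {m n} {i : Fin m} {j : Fin n} → i ↑ˡ n ≢ m ↑ʳ j
↑ˡ≢↑ʳ {m} {n} {i} {j} e
  with () ← trans (≡.sym (splitAt-↑ˡ m i n)) (trans (cong (splitAt m) e) (splitAt-↑ʳ m n j))

punchIn-or-pivot : ∀ {n} (v x : Fin (suc n)) → x ≡ v ⊎ ∃ λ i → punchIn v i ≡ x
punchIn-or-pivot v x with v ≟ x
... | yes v≡x = inj₁ (≡.sym v≡x)
... | no v≢x = inj₂ (punchOut v≢x , punchIn-punchOut v≢x)

module _ {n} (G : Graph n) where

  Adj-sym : ∀ {x y} → Adj G x y → Adj G y x
  Adj-sym {x} {y} a = trans (sym G y x) a

  Adj⇒≢ : ∀ {x y} → Adj G x y → x ≢ y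
  Adj⇒≢ {x} a refl with () ← trans (≡.sym a) (irrefl G x)

module _ {n} (G : Graph (suc n)) (v : Fin (suc n)) where

  contract-⊇ : ∀ {i j} → Adj G (punchIn v i) (punchIn v j) → Adj (contract G v) i j
  contract-⊇ a rewrite a = refl

  contract-clique : ∀ {i j} → Adj G v (punchIn v i) → Adj G v (punchIn v j) → i ≢ j →
                    Adj (contract G v) i j
  contract-clique {i} {j} vi vj i≢j with i ≟ j
  ... | yes i≡j = ⊥-elim (i≢j i≡j)
  ... | no _ rewrite vi | vj = ∨-zeroʳ _

  contract-⊆ : ∀ {i j} → Adj (contract G v) i j →
               Adj G (punchIn v i) (punchIn v j) ⊎ (Adj G v (punchIn v i) × Adj G v (punchIn v j) × i ≢ j)
  contract-⊆ {i} {j} a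
    with adj G (punchIn v i) (punchIn v j) | adj G v (punchIn v i) | adj G v (punchIn v j) | i ≟ j
  ... | true  | _    | _    | _        = inj₁ refl
  ... | false | true | true | no i≢j  = inj₂ (refl , refl , i≢j)
  ... | false | true | true | yes _   with () ← a
  ... | false | true | false | _      with () ← a
  ... | false | false | _    | _      with () ← a

count : ∀ {m} → (Fin m → Bool) → ℕ
count {zero}  P = 0
count {suc m} P = if P zero then suc (count (P ∘ suc)) else count (P ∘ suc)

rank : ∀ {m} → (Fin m → Bool) → Fin m → ℕ
rank P zero    = 0
rank P (suc x) = if P zero then suc (rank (P ∘ suc) x) else rank (P ∘ suc) x

rank<count : ∀ {m} (P : Fin m → Bool) {x} → P x ≡ true → rank P x < count P
rank<count P {zero}  Px rewrite Px = s≤s z≤n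
rank<count P {suc x} Px with P zero
... | true  = s≤s (rank<count (P ∘ suc) Px)
... | false = rank<count (P ∘ suc) Px

rank-injective : ∀ {m} (P : Fin m → Bool) {x y} → P x ≡ true → P y ≡ true →
                 rank P x ≡ rank P y → x ≡ y
rank-injective P {zero}  {zero}  _  _  _ = refl
rank-injective P {zero}  {suc y} Px _  e rewrite Px with () ← e
rank-injective P {suc x} {zero}  _  Py e rewrite Py with () ← e
rank-injective P {suc x} {suc y} Px Py e with P zero
... | true  = cong suc (rank-injective (P ∘ suc) Px Py (ℕ.suc-injective e))
... | false = cong suc (rank-injective (P ∘ suc) Px Py e)

rank-last-unique : ∀ {m} {P : Fin m → Bool} {d x y} → count P ≡ suc d →
                   P x ≡ true → P y ≡ true → d ≤ rank P x → d ≤ rank P y → x ≡ y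
rank-last-unique {P = P} {d} count≡ Px Py d≤x d≤y =
  rank-injective P Px Py (trans (≤-antisym (rank≤d Px) d≤x) (≡.sym (≤-antisym (rank≤d Py) d≤y)))
  where
  rank≤d : ∀ {z} → P z ≡ true → rank P z ≤ d
  rank≤d {z} Pz = m<1+n⇒m≤n (subst (rank P z <_) count≡ (rank<count P Pz))

count>0⇒∃ : ∀ {m} (P : Fin m → Bool) → 0 < count P → ∃ λ x → P x ≡ true
count>0⇒∃ {zero}  P ()
count>0⇒∃ {suc m} P h with P zero in Pz
... | true  = zero , Pz
... | false with count>0⇒∃ (P ∘ suc) h
...   | x , Px = suc x , Px

count≥2⇒another : ∀ {m} (P : Fin m → Bool) {x} → P x ≡ true → 2 ≤ count P →
                  ∃ λ y → y ≢ x × P y ≡ true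
count≥2⇒another P {zero} Px h rewrite Px with count>0⇒∃ (P ∘ suc) (s≤s⁻¹ h)
... | y , Py = suc y , (λ ()) , Py
count≥2⇒another P {suc x} Px h with P zero in Pz
... | true  = zero , (λ ()) , Pz
... | false with count≥2⇒another (P ∘ suc) Px h
...   | y , y≢x , Py = suc y , y≢x ∘ suc-injective , Py

count-punchIn : ∀ {m} (P : Fin (suc m) → Bool) v → P v ≡ false → count P ≡ count (P ∘ punchIn v)
count-punchIn P zero Pv rewrite Pv = refl
count-punchIn {suc m} P (suc v) Pv with P zero
... | true  = cong suc (count-punchIn (P ∘ suc) v Pv)
... | false = count-punchIn (P ∘ suc) v Pv

length-filterᵇ-tabulate : ∀ {A : Set} {m} (P : A → Bool) (f : Fin m → A) →
                          length (filterᵇ P (tabulate f)) ≡ count (P ∘ f)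
length-filterᵇ-tabulate {m = zero}  P f = refl
length-filterᵇ-tabulate {m = suc m} P f with P (f zero)
... | true  = cong suc (length-filterᵇ-tabulate P (f ∘ suc))
... | false = length-filterᵇ-tabulate P (f ∘ suc)

deg≡count : ∀ {n} (G : Graph (suc n)) v → deg G v ≡ count (adj G v ∘ punchIn v)
deg≡count G v = trans (length-filterᵇ-tabulate (adj G v) id) (count-punchIn (adj G v) v (irrefl G v))

module Recolouring {n K} (H : Graph n) (b : Fin n → Fin K)
    (S : Fin n → Set) (S? : ∀ x → Dec (S x)) (σ : ∀ x → S x → Fin K)
    (σ-injective : ∀ {x y} (sx : S x) (sy : S y) → σ x sx ≡ σ y sy → x ≡ y)
    (σ-fresh : ∀ {x y} (sx : S x) → ¬ S y → σ x sx ≢ b y) where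

  recolour : Fin n → Fin K
  recolour x with S? x
  ... | yes sx = σ x sx
  ... | no _   = b x

  recolour-kept : ∀ {x} → ¬ S x → recolour x ≡ b x
  recolour-kept {x} ¬sx with S? x
  ... | yes sx = ⊥-elim (¬sx sx)
  ... | no _   = refl

  recolour-singleton : ∀ {x} → S x → ∀ y → recolour y ≡ recolour x → y ≡ x
  recolour-singleton {x} sx y e with S? x | S? y
  ... | no ¬sx | _      = ⊥-elim (¬sx sx)
  ... | yes sx′ | yes sy = σ-injective sy sx′ e
  ... | yes sx′ | no ¬sy = ⊥-elim (σ-fresh sx′ ¬sy (≡.sym e))

  recolour-class-kept : ∀ {w z} → ¬ S z → recolour w ≡ b z → ¬ S w
  recolour-class-kept {w} {z} ¬sz e sw with recolour-singleton sw z (trans (recolour-kept ¬sz) (≡.sym e))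
  ... | refl = ¬sz sw

  recolour-proper : (∀ {x y} → ¬ S x → ¬ S y → Adj H x y → b x ≢ b y) → Proper H recolour
  recolour-proper b-proper x y a e = cases (S? x) (S? y)
    where
    cases : Dec (S x) → Dec (S y) → ⊥
    cases (yes sx) _        = Adj⇒≢ H a (≡.sym (recolour-singleton sx y (≡.sym e)))
    cases _        (yes sy) = Adj⇒≢ H a (recolour-singleton sy x e)
    cases (no ¬sx) (no ¬sy) =
      b-proper ¬sx ¬sy a (trans (≡.sym (recolour-kept ¬sx)) (trans e (recolour-kept ¬sy)))

  dominates-recoloured : ∀ {x y} → Adj H x y → S y → DominatesClass H recolour x (recolour y)
  dominates-recoloured {x} {y} a sy =
    (λ e → Adj⇒≢ H a (recolour-singleton sy x (≡.sym e))) , (y , refl) ,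
    λ z e → subst (Adj H x) (≡.sym (recolour-singleton sy z e)) a

  recolour-dominates : ∀ {x a} → DominatesClass H b x a → ∃ (DominatesClass H recolour x)
  recolour-dominates {x} {a} (a≢bx , (y , by≡a) , dom)
    with any? (λ z → ¬? (S? z) ×-dec (b z ≟ a))
  ... | yes (z , ¬sz , bz≡a) =
    a , (λ e → a≢bx (trans e (recolour-kept (recolour-class-kept ¬sz (trans (≡.sym e) (≡.sym bz≡a)))))) ,
    (z , trans (recolour-kept ¬sz) bz≡a) ,
    λ w e → dom w (trans (≡.sym (recolour-kept (recolour-class-kept ¬sz (trans e (≡.sym bz≡a))))) e)
  ... | no ¬kept = recolour y , dominates-recoloured (dom y by≡a) sy
    where
    sy : S y
    sy = decidable-stable (S? y) (λ ¬sy → ¬kept (y , ¬sy , by≡a))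

dominatesClass-map : ∀ {n k k′} {G : Graph n} {c : Fin n → Fin k} {x a} (f : Fin k → Fin k′) →
                     Injective _≡_ _≡_ f → DominatesClass G c x a → DominatesClass G (f ∘ c) x (f a)
dominatesClass-map f f-inj (a≢cx , (y , cy≡a) , dom) =
  a≢cx ∘ f-inj , (y , cong f cy≡a) , λ z e → dom z (f-inj e)

module _ {n} (G : Graph (suc n)) (v : Fin (suc n)) where

  dominatesClass-expand : ∀ {K} {c : Fin n → Fin K} {α i a} → (∀ j → c j ≢ α) →
                          adj G v (punchIn v i) ≡ false → DominatesClass (contract G v) c i a →
                          DominatesClass G (insertAt c v α) (punchIn v i) a
  dominatesClass-expand {c = c} {α} {i} {a} c≢α vi≡false (a≢ci , (j , cj≡a) , dom) =
    subst (a ≢_) (≡.sym (insertAt-punchIn c v α i)) a≢ci ,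
    (punchIn v j , trans (insertAt-punchIn c v α j) cj≡a) ,
    dom′
    where
    dom′ : ∀ y → insertAt c v α y ≡ a → Adj G (punchIn v i) y
    dom′ y e with punchIn-or-pivot v y
    ... | inj₁ refl = ⊥-elim (c≢α j (trans cj≡a (≡.sym (trans (≡.sym (insertAt-lookup c v α)) e))))
    ... | inj₂ (j′ , refl) with contract-⊆ G v (dom j′ (trans (≡.sym (insertAt-punchIn c v α j′)) e))
    ...   | inj₁ a′ = a′
    ...   | inj₂ (vi , _) with () ← trans (≡.sym vi≡false) vi

  dominatesClass-contract : ∀ {k} {c : Fin (suc n) → Fin k} {i a} → DominatesClass G c (punchIn v i) a →
                            DominatesClass (contract G v) (c ∘ punchIn v) i a
                            ⊎ (Adj G v (punchIn v i) × (∀ y → c y ≡ c v → y ≡ v))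
  dominatesClass-contract {c = c} {i} {a} (a≢c , (y , cy≡a) , dom) with any? (λ j → c (punchIn v j) ≟ a)
  ... | yes (j , cj≡a) = inj₁ (a≢c , (j , cj≡a) , λ j′ e → contract-⊇ G v (dom (punchIn v j′) e))
  ... | no ¬rest = inj₂ (Adj-sym G (dom v cv≡a) , λ z e → only-v z (trans e cv≡a))
    where
    only-v : ∀ z → c z ≡ a → z ≡ v
    only-v z e with punchIn-or-pivot v z
    ... | inj₁ z≡v = z≡v
    ... | inj₂ (j , refl) = ⊥-elim (¬rest (j , e))
    cv≡a : c v ≡ a
    cv≡a = subst (λ z → c z ≡ a) (only-v y cy≡a) cy≡a

hasTDColoring-expand : ∀ {n k′} (G : Graph (suc n)) (v : Fin (suc n)) {u} → Adj G v u →
                       HasTDColoring (contract G v) k′ → HasTDColoring G (k′ + 2)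
hasTDColoring-expand {n} {k′} G v {u} vu (c′ , c′-proper , c′-dominating) =
  recolour , recolour-proper b-proper , dominating
  where
  b : Fin (suc n) → Fin (k′ + 2)
  b = insertAt ((_↑ˡ 2) ∘ c′) v (k′ ↑ʳ zero)

  S : Fin (suc n) → Set
  S x = x ≡ v ⊎ x ≡ u

  σ : ∀ x → S x → Fin (k′ + 2)
  σ _ (inj₁ _) = k′ ↑ʳ zero
  σ _ (inj₂ _) = k′ ↑ʳ suc zero

  σ-injective : ∀ {x y} (sx : S x) (sy : S y) → σ x sx ≡ σ y sy → x ≡ y
  σ-injective (inj₁ refl) (inj₁ refl) _ = refl
  σ-injective (inj₂ refl) (inj₂ refl) _ = refl
  σ-injective (inj₁ _)    (inj₂ _)    e with () ← ↑ʳ-injective k′ zero (suc zero) e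
  σ-injective (inj₂ _)    (inj₁ _)    e with () ← ↑ʳ-injective k′ (suc zero) zero e

  σ-fresh : ∀ {x y} (sx : S x) → ¬ S y → σ x sx ≢ b y
  σ-fresh {y = y} sx ¬sy e with punchIn-or-pivot v y | sx
  ... | inj₁ y≡v        | _      = ¬sy (inj₁ y≡v)
  ... | inj₂ (j , refl) | inj₁ _ = ↑ˡ≢↑ʳ (≡.sym (trans e (insertAt-punchIn _ v _ j)))
  ... | inj₂ (j , refl) | inj₂ _ = ↑ˡ≢↑ʳ (≡.sym (trans e (insertAt-punchIn _ v _ j)))

  open Recolouring G b S (λ x → (x ≟ v) ⊎-dec (x ≟ u)) σ σ-injective σ-fresh

  b-proper : ∀ {x y} → ¬ S x → ¬ S y → Adj G x y → b x ≢ b y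
  b-proper {x} {y} ¬sx ¬sy a with punchIn-or-pivot v x | punchIn-or-pivot v y
  ... | inj₁ x≡v      | _              = ⊥-elim (¬sx (inj₁ x≡v))
  ... | _             | inj₁ y≡v       = ⊥-elim (¬sy (inj₁ y≡v))
  ... | inj₂ (i , refl) | inj₂ (j , refl) rewrite insertAt-punchIn ((_↑ˡ 2) ∘ c′) v (k′ ↑ʳ zero) i
                                              | insertAt-punchIn ((_↑ˡ 2) ∘ c′) v (k′ ↑ʳ zero) j =
    c′-proper i j (contract-⊇ G v a) ∘ ↑ˡ-injective 2 _ _

  dominating : ∀ x → ∃ (DominatesClass G recolour x)
  dominating x with punchIn-or-pivot v x
  ... | inj₁ refl = recolour u , dominates-recoloured vu (inj₂ refl)
  ... | inj₂ (i , refl) = by-adjacency-to-v (adj G v (punchIn v i)) refl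
    where
    by-adjacency-to-v : ∀ t → adj G v (punchIn v i) ≡ t → ∃ (DominatesClass G recolour (punchIn v i))
    by-adjacency-to-v true  vi = recolour v , dominates-recoloured (Adj-sym G vi) (inj₁ refl)
    by-adjacency-to-v false vi = recolour-dominates
      (dominatesClass-expand G v (λ _ → ↑ˡ≢↑ʳ) vi
        (dominatesClass-map {G = contract G v} (_↑ˡ 2) (↑ˡ-injective 2 _ _) (proj₂ (c′-dominating i))))

rankColour : ∀ {m} k {d} (P : Fin m → Bool) i → rank P i < d → Fin (k + d)
rankColour k P i r<d = k ↑ʳ fromℕ< r<d

rankColour-injective : ∀ {m k d} (P : Fin m → Bool) {i j} → P i ≡ true → P j ≡ true →
                       (ri : rank P i < d) (rj : rank P j < d) →
                       rankColour k P i ri ≡ rankColour k P j rj → i ≡ j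
rankColour-injective {k = k} P Pi Pj ri rj e =
  rank-injective P Pi Pj
    (trans (≡.sym (toℕ-fromℕ< ri)) (trans (cong toℕ (↑ʳ-injective k _ _ e)) (toℕ-fromℕ< rj)))

module ContractColouring {n k} (G : Graph (suc n)) (v : Fin (suc n))
    {c : Fin (suc n) → Fin k} (c-td : IsTDColoring G c) where

  H : Graph n
  H = contract G v

  N : Fin n → Bool
  N = adj G v ∘ punchIn v

  restricted : ∀ d → Fin n → Fin (k + d)
  restricted d i = c (punchIn v i) ↑ˡ d

  VAloneInItsClass : Set
  VAloneInItsClass = ∀ y → c y ≡ c v → y ≡ v

  restricted-proper : ∀ d {i j} → (N i ≡ true → N j ≡ true → i ≡ j) → Adj H i j →
                      restricted d i ≢ restricted d j
  restricted-proper d not-clique a e with contract-⊆ G v a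
  ... | inj₁ a′               = proj₁ c-td _ _ a′ (↑ˡ-injective d _ _ e)
  ... | inj₂ (Ni , Nj , i≢j) = i≢j (not-clique Ni Nj)

  dominating-or-alone : ∀ d i → ∃ (DominatesClass H (restricted d) i) ⊎ (N i ≡ true × VAloneInItsClass)
  dominating-or-alone d i with dominatesClass-contract G v (proj₂ (proj₂ c-td (punchIn v i)))
  ... | inj₁ dom   = inj₁ (_ , dominatesClass-map {G = H} (_↑ˡ d) (↑ˡ-injective d _ _) dom)
  ... | inj₂ alone = inj₂ alone

  hasTDColoring-shared : ∀ {d w} → count N ≡ suc d → w ≢ v → c w ≡ c v → HasTDColoring H (k + d)
  hasTDColoring-shared {d} {w} count≡ w≢v cw≡cv = recolour , recolour-proper kept-proper , dominating
    where
    S : Fin n → Set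
    S i = N i ≡ true × rank N i < d

    σ : ∀ i → S i → Fin (k + d)
    σ i (_ , r<d) = rankColour k N i r<d

    σ-injective : ∀ {i j} (si : S i) (sj : S j) → σ i si ≡ σ j sj → i ≡ j
    σ-injective (Ni , ri) (Nj , rj) = rankColour-injective N Ni Nj ri rj

    σ-fresh : ∀ {i j} (si : S i) → ¬ S j → σ i si ≢ restricted d j
    σ-fresh _ _ e = ↑ˡ≢↑ʳ (≡.sym e)

    open Recolouring H (restricted d) S (λ i → (N i ≟ᵇ true) ×-dec (rank N i <? d)) σ σ-injective σ-fresh

    kept-proper : ∀ {i j} → ¬ S i → ¬ S j → Adj H i j → restricted d i ≢ restricted d j
    kept-proper ¬si ¬sj = restricted-proper d λ Ni Nj →
      rank-last-unique count≡ Ni Nj (≮⇒≥ (¬si ∘ (Ni ,_))) (≮⇒≥ (¬sj ∘ (Nj ,_)))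

    dominating : ∀ i → ∃ (DominatesClass H recolour i)
    dominating i with dominating-or-alone d i
    ... | inj₁ (_ , dom)  = recolour-dominates dom
    ... | inj₂ (_ , alone) = ⊥-elim (w≢v (alone w cw≡cv))

  hasTDColoring-alone : ∀ {d} → count N ≡ suc (suc d) → VAloneInItsClass → HasTDColoring H (k + suc d)
  hasTDColoring-alone {d} count≡ alone = recolour , recolour-proper kept-proper , dominating
    where
    S : Fin n → Set
    S i = N i ≡ true

    σ : ∀ i → S i → Fin (k + suc d)
    σ i _ with rank N i <? suc d
    ... | yes r<d = rankColour k N i r<d
    ... | no _    = c v ↑ˡ suc d

    σ-injective : ∀ {i j} (si : S i) (sj : S j) → σ i si ≡ σ j sj → i ≡ j
    σ-injective {i} {j} Ni Nj e with rank N i <? suc d | rank N j <? suc d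
    ... | yes ri  | yes rj  = rankColour-injective N Ni Nj ri rj e
    ... | yes _   | no _    = ⊥-elim (↑ˡ≢↑ʳ (≡.sym e))
    ... | no _    | yes _   = ⊥-elim (↑ˡ≢↑ʳ e)
    ... | no ri≮d | no rj≮d = rank-last-unique count≡ Ni Nj (≮⇒≥ ri≮d) (≮⇒≥ rj≮d)

    σ-fresh : ∀ {i j} (si : S i) → ¬ S j → σ i si ≢ restricted (suc d) j
    σ-fresh {i} {j} _ _ e with rank N i <? suc d
    ... | yes _ = ↑ˡ≢↑ʳ (≡.sym e)
    ... | no _  = punchInᵢ≢i v j (alone _ (≡.sym (↑ˡ-injective (suc d) _ _ e)))

    open Recolouring H (restricted (suc d)) S (λ i → N i ≟ᵇ true) σ σ-injective σ-fresh

    kept-proper : ∀ {i j} → ¬ S i → ¬ S j → Adj H i j → restricted (suc d) i ≢ restricted (suc d) j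
    kept-proper ¬si _ = restricted-proper (suc d) λ Ni _ → ⊥-elim (¬si Ni)

    dominating : ∀ i → ∃ (DominatesClass H recolour i)
    dominating i with dominating-or-alone (suc d) i
    ... | inj₁ (_ , dom) = recolour-dominates dom
    ... | inj₂ (Ni , _) with count≥2⇒another N Ni (subst (2 ≤_) (≡.sym count≡) (s≤s (s≤s z≤n)))
    ...   | j , j≢i , Nj = recolour j , dominates-recoloured (contract-clique G v Ni Nj (j≢i ∘ ≡.sym)) Nj

  hasTDColoring-leaf : ∀ {u} → count N ≡ 1 → N u ≡ true → VAloneInItsClass → NoIsolated H →
                       HasTDColoring H (k + 0)
  hasTDColoring-leaf {u} count≡ Nu alone H-noIsolated = recolour , recolour-proper kept-proper , dominating
    where
    w : Fin n
    w = proj₁ (H-noIsolated u)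

    S : Fin n → Set
    S i = i ≡ w

    σ : ∀ i → S i → Fin (k + 0)
    σ _ _ = c v ↑ˡ 0

    σ-injective : ∀ {i j} (si : S i) (sj : S j) → σ i si ≡ σ j sj → i ≡ j
    σ-injective refl refl _ = refl

    σ-fresh : ∀ {i j} (si : S i) → ¬ S j → σ i si ≢ restricted 0 j
    σ-fresh {j = j} _ _ e = punchInᵢ≢i v j (alone _ (≡.sym (↑ˡ-injective 0 _ _ e)))

    open Recolouring H (restricted 0) S (_≟ w) σ σ-injective σ-fresh

    kept-proper : ∀ {i j} → ¬ S i → ¬ S j → Adj H i j → restricted 0 i ≢ restricted 0 j
    kept-proper _ _ = restricted-proper 0 λ Ni Nj → rank-last-unique count≡ Ni Nj z≤n z≤n

    dominating : ∀ i → ∃ (DominatesClass H recolour i)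
    dominating i with dominating-or-alone 0 i
    ... | inj₁ (_ , dom) = recolour-dominates dom
    ... | inj₂ (Ni , _) with rank-last-unique {x = i} {y = u} count≡ Ni Nu z≤n z≤n
    ...   | refl = recolour w , dominates-recoloured (proj₂ (H-noIsolated u)) refl

  unshared⇒alone : ¬ (∃ λ w → w ≢ v × c w ≡ c v) → VAloneInItsClass
  unshared⇒alone ¬shared y cy≡cv = decidable-stable (y ≟ v) (λ y≢v → ¬shared (y , y≢v , cy≡cv))

  hasTDColoring-contract : NoIsolated G → NoIsolated H → ∃ λ d → suc d ≡ deg G v × HasTDColoring H (k + d)
  hasTDColoring-contract G-noIsolated H-noIsolated with G-noIsolated v
  ... | x , vx with punchIn-or-pivot v x
  ...   | inj₁ refl = ⊥-elim (Adj⇒≢ G vx refl)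
  ...   | inj₂ (u , refl) with count N in count≡
  ...     | zero  with () ← subst (rank N u <_) count≡ (rank<count N vx)
  ...     | suc d = d , ≡.sym (trans (deg≡count G v) count≡) , colouring d count≡
    where
    colouring : ∀ d → count N ≡ suc d → HasTDColoring H (k + d)
    colouring d count≡ with any? (λ w → ¬? (w ≟ v) ×-dec (c w ≟ c v)) | d
    ... | yes (w , w≢v , cw≡cv) | _ = hasTDColoring-shared count≡ w≢v cw≡cv
    ... | no ¬shared | zero  = hasTDColoring-leaf count≡ vx (unshared⇒alone ¬shared) H-noIsolated
    ... | no ¬shared | suc _ = hasTDColoring-alone count≡ (unshared⇒alone ¬shared)

m≤n+o⇒m+1≤n+[1+o] : ∀ {m n o} → m ≤ n + o → m + 1 ≤ n + suc o
m≤n+o⇒m+1≤n+[1+o] {m} {n} {o} h rewrite +-comm m 1 | +-suc n o = s≤s h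

theorem3p3 : ∀ {n} (G : Graph (suc n)) (v : Fin (suc n)) →
    Connected G → NoIsolated G → NoIsolated (contract G v) →
    ∀ k k' → IsChiDT G k → IsChiDT (contract G v) k' →
    (k ≤ k' + 2) × (k' + 1 ≤ k + deg G v)
theorem3p3 G v _ G-noIsolated H-noIsolated k k′ ((c , c-td) , k-minimal) (H-coloured , k′-minimal) =
  k-minimal (k′ + 2) (hasTDColoring-expand G v (proj₂ (G-noIsolated v)) H-coloured) , upper
  where
  open ContractColouring G v c-td using (hasTDColoring-contract)

  upper : k′ + 1 ≤ k + deg G v
  upper with hasTDColoring-contract G-noIsolated H-noIsolated
  ... | d , suc-d≡deg , coloured =
    subst (λ m → k′ + 1 ≤ k + m) suc-d≡deg (m≤n+o⇒m+1≤n+[1+o] (k′-minimal (k + d) coloured))
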